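{- Let $G(5)$ be the Petersen graph. Then $\gamma_R(G(5))=6$, and $G(5)$ is not a special Roman graph.
   Context: The Petersen graph $G(5)$ has vertex set $\{1,\ldots,10\}$ and edge set $\{\{i,i+1\}:1\leq i\leq 9\}\cup\{\{6,10\},\{1,5\},\{1,9\},\{2,7\},\{3,10\},\{4,8\}\}$. A Roman dominating function (RDF) of $G=(V,E)$ is a function $f:V\to\{0,1,2\}$ such that every vertex $v$ with $f(v)=0$ has a neighbor $w$ with $f(w)=2$; its weight is $\sum_v f(v)$, $\gamma_R(G)$ is the minimum weight of an RDF, and a $\gamma_R$-function is an RDF of weight $\gamma_R(G)$. Write $f=(V_0,V_1,V_2)$ with $V_i=\{v:f(v)=i\}$. $G$ is a special Roman graph if it has a $\gamma_R$-function $f=(V_0,V_1,V_2)$ with $V_1=\emptyset$ such that the induced subgraph $G[V_2]$ has no isolated vertex. -}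

module Defs where

open import Data.Nat using (ℕ; _+_; _≤_)
open import Data.Fin using (Fin)
open import Data.Fin.Patterns
open import Data.List using (List; _∷_; []; map; allFin)
open import Data.Nat.ListAction using (sum)
open import Data.Product using (Σ; ∃; _×_; _,_)
open import Data.Sum using (_⊎_)
open import Relation.Binary.PropositionalEquality using (_≡_; _≢_)
open import Relation.Nullary using (¬_)

record Graph (n : ℕ) : Set₁ where
  field
    Adj : Fin n → Fin n → Set

open Graph public

data Label : Set where
  l0 l1 l2 : Label

val : Label → ℕ
val l0 = 0
val l1 = 1
val l2 = 2

weight : ∀ {n} → (Fin n → Label) → ℕ
weight {n} f = sum (map (λ v → val (f v)) (allFin n))

IsRDF : ∀ {n} → Graph n → (Fin n → Label) → Set
IsRDF G f = ∀ v → f v ≡ l0 → ∃ λ w → Adj G v w × f w ≡ l2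

IsGammaRFunction : ∀ {n} → Graph n → (Fin n → Label) → Set
IsGammaRFunction {n} G f =
  IsRDF G f × (∀ (g : Fin n → Label) → IsRDF G g → weight f ≤ weight g)

RomanDominationNumber≡ : ∀ {n} → Graph n → ℕ → Set
RomanDominationNumber≡ {n} G k =
  (∃ λ (f : Fin n → Label) → IsRDF G f × weight f ≡ k)
  × (∀ (g : Fin n → Label) → IsRDF G g → k ≤ weight g)

IsSpecialRoman : ∀ {n} → Graph n → Set
IsSpecialRoman {n} G = ∃ λ (f : Fin n → Label) →
  IsGammaRFunction G f
  × (∀ v → f v ≢ l1)
  × (∀ v → f v ≡ l2 → ∃ λ w → Adj G v w × f w ≡ l2)

-- Petersen graph G(5): paper vertex i is represented by Fin index i-1.
-- Edge list from the paper: {i,i+1} (1≤i≤9), {6,10},{1,5},{1,9},{2,7},{3,10},{4,8}.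
data PetersenEdge : Fin 10 → Fin 10 → Set where
  e1-2  : PetersenEdge 0F 1F
  e2-3  : PetersenEdge 1F 2F
  e3-4  : PetersenEdge 2F 3F
  e4-5  : PetersenEdge 3F 4F
  e5-6  : PetersenEdge 4F 5F
  e6-7  : PetersenEdge 5F 6F
  e7-8  : PetersenEdge 6F 7F
  e8-9  : PetersenEdge 7F 8F
  e9-10 : PetersenEdge 8F 9F
  e6-10 : PetersenEdge 5F 9F
  e1-5  : PetersenEdge 0F 4F
  e1-9  : PetersenEdge 0F 8F
  e2-7  : PetersenEdge 1F 6F
  e3-10 : PetersenEdge 2F 9F
  e4-8  : PetersenEdge 3F 7F

Petersen : Graph 10
Petersen = record { Adj = λ u v → PetersenEdge u v ⊎ PetersenEdge v u }

-- Every vertex lies in the closed neighbourhood of exactly k + 1 vertices of a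
-- k-regular graph, so counting pairs (v, w) with w labelled 2 and w in the
-- closed neighbourhood of v gives n ≤ n₁ + (k + 1) n₂ for any Roman dominating
-- function with n₁ ones and n₂ twos. For the Petersen graph this reads
-- 10 ≤ n₁ + 4 n₂, which forces the weight n₁ + 2 n₂ to be at least 6 (weight 5
-- would need n₁ = 0 and 4 n₂ = 10). If there are no ones and every 2 has a
-- neighbouring 2, each vertex labelled 2 is counted at least twice, so
-- 10 + n₂ ≤ 4 n₂; then n₂ ≥ 4 and the weight is at least 8, so such a function
-- is never minimal.
module Submission where

open import Defs
open import Data.Nat using (ℕ; suc; _+_; _*_; _≤_; _≰_; z≤n; s≤s)
open import Data.Nat.Properties
  using (≤-refl; ≤-trans; +-mono-≤; +-monoˡ-≤; +-cancelˡ-≤; +-cancelʳ-≤; *-monoʳ-≤;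
         *-cancelˡ-≤; *-zeroʳ; *-distribˡ-+; *-distribʳ-+; +-identityʳ; +-comm; m≤m+n; m≤n+m; 1+n≰n; module ≤-Reasoning)
open import Data.Nat.ListAction using (sum)
open import Data.Nat.Tactic.RingSolver using (solve-∀)
open import Data.Fin using (Fin)
import Data.Fin as Fin
open import Data.Fin.Properties using (_≟_)
open import Data.Fin.Patterns
open import Data.List using (List; []; _∷_; map; allFin; length)
open import Data.List.Properties using (length-tabulate; map-tabulate; map-cong)
open import Data.List.Membership.Propositional using (_∈_)
open import Data.List.Membership.DecPropositional (_≟_ {10}) using (_∈?_)
open import Data.List.Relation.Unary.Any using (here; there)
open import Data.Product using (_×_; _,_; proj₁; proj₂; ∃)
open import Data.Sum using (inj₁; inj₂)
open import Data.Empty using (⊥-elim)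
open import Function using (_∘_; id)
open import Data.Bool using (if_then_else_)
open import Relation.Nullary using (¬_; does)
open import Relation.Nullary.Decidable using (True; toWitness)
open import Relation.Binary.PropositionalEquality using (_≡_; _≢_; refl; sym; trans; cong; cong₂; subst; module ≡-Reasoning)

private
  variable
    A B : Set

sum-map-mono : ∀ {g h : A → ℕ} (xs : List A) → (∀ x → g x ≤ h x) →
               sum (map g xs) ≤ sum (map h xs)
sum-map-mono []       _   = z≤n
sum-map-mono (x ∷ xs) g≤h = +-mono-≤ (g≤h x) (sum-map-mono xs g≤h)

sum-map-+ : ∀ (g h : A → ℕ) xs →
            sum (map (λ x → g x + h x) xs) ≡ sum (map g xs) + sum (map h xs)
sum-map-+ g h []       = refl
sum-map-+ g h (x ∷ xs) rewrite sum-map-+ g h xs = lemma (g x) (h x) (sum (map g xs)) (sum (map h xs))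
  where
  lemma : ∀ a b c d → (a + b) + (c + d) ≡ (a + c) + (b + d)
  lemma = solve-∀

sum-map-zero : (xs : List A) → sum (map (λ _ → 0) xs) ≡ 0
sum-map-zero []       = refl
sum-map-zero (x ∷ xs) = sum-map-zero xs

sum-map-*ˡ : ∀ c (g : A → ℕ) xs → sum (map (λ x → c * g x) xs) ≡ c * sum (map g xs)
sum-map-*ˡ c g []       = sym (*-zeroʳ c)
sum-map-*ˡ c g (x ∷ xs) rewrite sum-map-*ˡ c g xs = sym (*-distribˡ-+ c (g x) (sum (map g xs)))

sum-map-*ʳ : ∀ c (g : A → ℕ) xs → sum (map (λ x → g x * c) xs) ≡ sum (map g xs) * c
sum-map-*ʳ c g []       = refl
sum-map-*ʳ c g (x ∷ xs) rewrite sum-map-*ʳ c g xs = sym (*-distribʳ-+ c (g x) (sum (map g xs)))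

sum-map-swap : ∀ (F : A → B → ℕ) xs (ys : List B) →
               sum (map (λ x → sum (map (F x) ys)) xs) ≡ sum (map (λ y → sum (map (λ x → F x y) xs)) ys)
sum-map-swap F []       ys = sym (sum-map-zero ys)
sum-map-swap F (x ∷ xs) ys rewrite sum-map-swap F xs ys =
  sym (sum-map-+ (F x) (λ y → sum (map (λ x → F x y) xs)) ys)

sum-map-one : (xs : List A) → sum (map (λ _ → 1) xs) ≡ length xs
sum-map-one []       = refl
sum-map-one (x ∷ xs) = cong suc (sum-map-one xs)

∈⇒≤sum-map : ∀ (h : A → ℕ) {x xs} → x ∈ xs → h x ≤ sum (map h xs)
∈⇒≤sum-map h (here refl)  = m≤m+n _ _
∈⇒≤sum-map h (there x∈xs) = ≤-trans (∈⇒≤sum-map h x∈xs) (m≤n+m _ _)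

total : ∀ {n} → (Fin n → ℕ) → ℕ
total {n} h = sum (map h (allFin n))

total-ones : ∀ n → total {n} (λ _ → 1) ≡ n
total-ones n = trans (sum-map-one (allFin n)) (length-tabulate id)

total-suc : ∀ {n} (g : Fin (suc n) → ℕ) → total g ≡ g 0F + total (g ∘ Fin.suc)
total-suc g = cong (g 0F +_) (cong sum (trans (map-tabulate Fin.suc g) (sym (map-tabulate id (g ∘ Fin.suc)))))

δ : ∀ {n} → Fin n → Fin n → ℕ
δ v w = if does (v ≟ w) then 1 else 0

total-δ : ∀ {n} (h : Fin n → ℕ) x → total (λ w → δ w x * h w) ≡ h x
total-δ {suc n} h 0F = begin
  total (λ w → δ w 0F * h w)          ≡⟨ total-suc (λ w → δ w 0F * h w) ⟩
  (h 0F + 0) + total {n} (λ _ → 0)    ≡⟨ cong₂ _+_ (+-identityʳ (h 0F)) (sum-map-zero (allFin n)) ⟩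
  h 0F + 0                            ≡⟨ +-identityʳ (h 0F) ⟩
  h 0F                                ∎
  where open ≡-Reasoning
total-δ {suc n} h (Fin.suc x) = trans (total-suc (λ w → δ w (Fin.suc x) * h w)) (total-δ (h ∘ Fin.suc) x)

occurrences : ∀ {n} → Fin n → List (Fin n) → ℕ
occurrences w xs = sum (map (δ w) xs)

sum-map≡total-occurrences : ∀ {n} (h : Fin n → ℕ) xs →
                            sum (map h xs) ≡ total (λ w → occurrences w xs * h w)
sum-map≡total-occurrences {n} h []       = sym (sum-map-zero (allFin n))
sum-map≡total-occurrences {n} h (x ∷ xs) = begin
  h x + sum (map h xs)
    ≡⟨ cong₂ _+_ (total-δ h x) (sym (sum-map≡total-occurrences h xs)) ⟨
  total (λ w → δ w x * h w) + total (λ w → occurrences w xs * h w)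
    ≡⟨ sum-map-+ (λ w → δ w x * h w) (λ w → occurrences w xs * h w) (allFin n) ⟨
  total (λ w → δ w x * h w + occurrences w xs * h w)
    ≡⟨ cong sum (map-cong (λ w → *-distribʳ-+ (h w) (δ w x) (occurrences w xs)) (allFin n)) ⟨
  total (λ w → occurrences w (x ∷ xs) * h w) ∎
  where open ≡-Reasoning

double-count : ∀ {n} (N : Fin n → List (Fin n)) k →
               (∀ w → total (λ v → occurrences w (N v)) ≡ k) →
               ∀ h → total (λ v → sum (map h (N v))) ≡ k * total h
double-count {n} N k in-degree h = begin
  total (λ v → sum (map h (N v)))
    ≡⟨ cong sum (map-cong (λ v → sum-map≡total-occurrences h (N v)) (allFin n)) ⟩
  total (λ v → total (λ w → occurrences w (N v) * h w))
    ≡⟨ sum-map-swap (λ v w → occurrences w (N v) * h w) (allFin n) (allFin n) ⟩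
  total (λ w → total (λ v → occurrences w (N v) * h w))
    ≡⟨ cong sum (map-cong (λ w → sum-map-*ʳ (h w) (λ v → occurrences w (N v)) (allFin n)) (allFin n)) ⟩
  total (λ w → total (λ v → occurrences w (N v)) * h w)
    ≡⟨ cong sum (map-cong (λ w → cong (_* h w) (in-degree w)) (allFin n)) ⟩
  total (λ w → k * h w)
    ≡⟨ sum-map-*ˡ k h (allFin n) ⟩
  k * total h ∎
  where open ≡-Reasoning

χ₁ χ₂ : Label → ℕ
χ₁ l1 = 1
χ₁ _  = 0
χ₂ l2 = 1
χ₂ _  = 0

val≡χ₁+2χ₂ : ∀ l → val l ≡ χ₁ l + 2 * χ₂ l
val≡χ₁+2χ₂ l0 = refl
val≡χ₁+2χ₂ l1 = refl
val≡χ₁+2χ₂ l2 = refl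

weight≡ones+2twos : ∀ {n} (f : Fin n → Label) →
                    weight f ≡ total (χ₁ ∘ f) + 2 * total (χ₂ ∘ f)
weight≡ones+2twos {n} f = begin
  sum (map (val ∘ f) (allFin n))
    ≡⟨ cong sum (map-cong (val≡χ₁+2χ₂ ∘ f) (allFin n)) ⟩
  sum (map (λ v → χ₁ (f v) + 2 * χ₂ (f v)) (allFin n))
    ≡⟨ sum-map-+ (χ₁ ∘ f) (λ v → 2 * χ₂ (f v)) (allFin n) ⟩
  total (χ₁ ∘ f) + total (λ v → 2 * χ₂ (f v))
    ≡⟨ cong (total (χ₁ ∘ f) +_) (sum-map-*ˡ 2 (χ₂ ∘ f) (allFin n)) ⟩
  total (χ₁ ∘ f) + 2 * total (χ₂ ∘ f) ∎
  where open ≡-Reasoning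

HasTwoNeighbour : ∀ {n} → Graph n → (Fin n → Label) → Fin n → Set
HasTwoNeighbour G f v = ∃ λ w → Adj G v w × f w ≡ l2

TwosPaired : ∀ {n} → Graph n → (Fin n → Label) → Set
TwosPaired G f = ∀ v → f v ≡ l2 → HasTwoNeighbour G f v

module RegularCounting {n} (G : Graph n) (N : Fin n → List (Fin n)) (k : ℕ)
  (adj⇒∈N : ∀ {v w} → Adj G v w → w ∈ N v)
  (in-degree : ∀ w → total (λ v → occurrences w (N v)) ≡ k)
  where

  twosAround : (Fin n → Label) → Fin n → ℕ
  twosAround f v = χ₂ (f v) + sum (map (χ₂ ∘ f) (N v))

  total-twosAround : ∀ f → total (twosAround f) ≡ suc k * total (χ₂ ∘ f)
  total-twosAround f = begin
    total (twosAround f)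
      ≡⟨ sum-map-+ (χ₂ ∘ f) (λ v → sum (map (χ₂ ∘ f) (N v))) (allFin n) ⟩
    total (χ₂ ∘ f) + total (λ v → sum (map (χ₂ ∘ f) (N v)))
      ≡⟨ cong (total (χ₂ ∘ f) +_) (double-count N k in-degree (χ₂ ∘ f)) ⟩
    total (χ₂ ∘ f) + k * total (χ₂ ∘ f) ∎
    where open ≡-Reasoning

  two-neighbour : ∀ {f v} → HasTwoNeighbour G f v → 1 ≤ sum (map (χ₂ ∘ f) (N v))
  two-neighbour {f} (w , v~w , fw≡2) =
    ≤-trans (subst (λ l → 1 ≤ χ₂ l) (sym fw≡2) ≤-refl) (∈⇒≤sum-map (χ₂ ∘ f) (adj⇒∈N v~w))

  rdf-covers : ∀ {f} → IsRDF G f → ∀ v → 1 ≤ χ₁ (f v) + twosAround f v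
  rdf-covers {f} rdf v with f v in fv
  ... | l0 = two-neighbour (rdf v fv)
  ... | l1 = s≤s z≤n
  ... | l2 = s≤s z≤n

  paired-covers : ∀ {f} → IsRDF G f → (∀ v → f v ≢ l1) → TwosPaired G f →
                  ∀ v → 1 + χ₂ (f v) ≤ twosAround f v
  paired-covers {f} rdf no1 paired v with f v in fv
  ... | l0 = two-neighbour (rdf v fv)
  ... | l1 = ⊥-elim (no1 v fv)
  ... | l2 = s≤s (two-neighbour (paired v fv))

  rdf-bound : ∀ {f} → IsRDF G f → n ≤ total (χ₁ ∘ f) + suc k * total (χ₂ ∘ f)
  rdf-bound {f} rdf = begin
    n                                                ≡⟨ total-ones n ⟨
    total {n} (λ _ → 1)                              ≤⟨ sum-map-mono (allFin n) (rdf-covers rdf) ⟩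
    total (λ v → χ₁ (f v) + twosAround f v)          ≡⟨ sum-map-+ (χ₁ ∘ f) (twosAround f) (allFin n) ⟩
    total (χ₁ ∘ f) + total (twosAround f)            ≡⟨ cong (total (χ₁ ∘ f) +_) (total-twosAround f) ⟩
    total (χ₁ ∘ f) + suc k * total (χ₂ ∘ f)          ∎
    where open ≤-Reasoning

  paired-bound : ∀ {f} → IsRDF G f → (∀ v → f v ≢ l1) → TwosPaired G f →
                 n + total (χ₂ ∘ f) ≤ suc k * total (χ₂ ∘ f)
  paired-bound {f} rdf no1 paired = begin
    n + total (χ₂ ∘ f)                    ≡⟨ cong (_+ total (χ₂ ∘ f)) (total-ones n) ⟨
    total {n} (λ _ → 1) + total (χ₂ ∘ f)  ≡⟨ sum-map-+ (λ _ → 1) (χ₂ ∘ f) (allFin n) ⟨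
    total (λ v → 1 + χ₂ (f v))            ≤⟨ sum-map-mono (allFin n) (paired-covers rdf no1 paired) ⟩
    total (twosAround f)                  ≡⟨ total-twosAround f ⟩
    suc k * total (χ₂ ∘ f)                ∎
    where open ≤-Reasoning

petersenNeighbours : Fin 10 → List (Fin 10)
petersenNeighbours 0F = 1F ∷ 4F ∷ 8F ∷ []
petersenNeighbours 1F = 0F ∷ 2F ∷ 6F ∷ []
petersenNeighbours 2F = 1F ∷ 3F ∷ 9F ∷ []
petersenNeighbours 3F = 2F ∷ 4F ∷ 7F ∷ []
petersenNeighbours 4F = 0F ∷ 3F ∷ 5F ∷ []
petersenNeighbours 5F = 4F ∷ 6F ∷ 9F ∷ []
petersenNeighbours 6F = 1F ∷ 5F ∷ 7F ∷ []
petersenNeighbours 7F = 3F ∷ 6F ∷ 8F ∷ []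
petersenNeighbours 8F = 0F ∷ 7F ∷ 9F ∷ []
petersenNeighbours 9F = 2F ∷ 5F ∷ 8F ∷ []

listed-both : ∀ v w {_ : True (w ∈? petersenNeighbours v)} {_ : True (v ∈? petersenNeighbours w)} →
              w ∈ petersenNeighbours v × v ∈ petersenNeighbours w
listed-both v w {w∈N} {v∈N} = toWitness w∈N , toWitness v∈N

edge-listed : ∀ {v w} → PetersenEdge v w → w ∈ petersenNeighbours v × v ∈ petersenNeighbours w
edge-listed {v} {w} e1-2  = listed-both v w
edge-listed {v} {w} e2-3  = listed-both v w
edge-listed {v} {w} e3-4  = listed-both v w
edge-listed {v} {w} e4-5  = listed-both v w
edge-listed {v} {w} e5-6  = listed-both v w
edge-listed {v} {w} e6-7  = listed-both v w
edge-listed {v} {w} e7-8  = listed-both v w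
edge-listed {v} {w} e8-9  = listed-both v w
edge-listed {v} {w} e9-10 = listed-both v w
edge-listed {v} {w} e6-10 = listed-both v w
edge-listed {v} {w} e1-5  = listed-both v w
edge-listed {v} {w} e1-9  = listed-both v w
edge-listed {v} {w} e2-7  = listed-both v w
edge-listed {v} {w} e3-10 = listed-both v w
edge-listed {v} {w} e4-8  = listed-both v w

adj⇒listed : ∀ {v w} → Adj Petersen v w → w ∈ petersenNeighbours v
adj⇒listed (inj₁ e) = proj₁ (edge-listed e)
adj⇒listed (inj₂ e) = proj₂ (edge-listed e)

petersen-in-degree : ∀ w → total (λ v → occurrences w (petersenNeighbours v)) ≡ 3
petersen-in-degree 0F = refl
petersen-in-degree 1F = refl
petersen-in-degree 2F = refl
petersen-in-degree 3F = refl
petersen-in-degree 4F = refl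
petersen-in-degree 5F = refl
petersen-in-degree 6F = refl
petersen-in-degree 7F = refl
petersen-in-degree 8F = refl
petersen-in-degree 9F = refl

open RegularCounting Petersen petersenNeighbours 3 adj⇒listed petersen-in-degree

weightSixRDF : Fin 10 → Label
weightSixRDF 4F = l2
weightSixRDF 6F = l2
weightSixRDF 9F = l2
weightSixRDF _  = l0

weightSixRDF-isRDF : IsRDF Petersen weightSixRDF
weightSixRDF-isRDF 0F _ = 4F , inj₁ e1-5 , refl
weightSixRDF-isRDF 1F _ = 6F , inj₁ e2-7 , refl
weightSixRDF-isRDF 2F _ = 9F , inj₁ e3-10 , refl
weightSixRDF-isRDF 3F _ = 4F , inj₁ e4-5 , refl
weightSixRDF-isRDF 5F _ = 4F , inj₂ e5-6 , refl
weightSixRDF-isRDF 7F _ = 6F , inj₂ e7-8 , refl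
weightSixRDF-isRDF 8F _ = 9F , inj₁ e9-10 , refl
weightSixRDF-isRDF 4F ()
weightSixRDF-isRDF 6F ()
weightSixRDF-isRDF 9F ()

10≤o+4t⇒6≤o+2t : ∀ o t → 10 ≤ o + 4 * t → 6 ≤ o + 2 * t
10≤o+4t⇒6≤o+2t o 0 h = ≤-trans (m≤m+n 6 4) h
10≤o+4t⇒6≤o+2t o 1 h = ≤-trans (+-cancelʳ-≤ 4 6 o h) (m≤m+n o 2)
10≤o+4t⇒6≤o+2t o 2 h = +-monoˡ-≤ 4 (+-cancelʳ-≤ 8 2 o h)
10≤o+4t⇒6≤o+2t o (suc (suc (suc t))) _ = ≤-trans (*-monoʳ-≤ 2 (m≤m+n 3 t)) (m≤n+m _ o)

10+t≤4t⇒2t≰6 : ∀ t → 10 + t ≤ 4 * t → 2 * t ≰ 6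
10+t≤4t⇒2t≰6 t h 2t≤6 = 1+n≰n (≤-trans ten≤3t (*-monoʳ-≤ 3 t≤3))
  where
  t≤3 : t ≤ 3
  t≤3 = *-cancelˡ-≤ 2 2t≤6
  ten≤3t : 10 ≤ 3 * t
  ten≤3t = +-cancelˡ-≤ t 10 (3 * t) (subst (_≤ 4 * t) (+-comm 10 t) h)

proposition9 : RomanDominationNumber≡ Petersen 6 × ¬ IsSpecialRoman Petersen
proposition9 = ((weightSixRDF , weightSixRDF-isRDF , refl) , six≤weight) , not-special
  where
  six≤weight : ∀ g → IsRDF Petersen g → 6 ≤ weight g
  six≤weight g rdf =
    subst (6 ≤_) (sym (weight≡ones+2twos g)) (10≤o+4t⇒6≤o+2t (total (χ₁ ∘ g)) (total (χ₂ ∘ g)) (rdf-bound rdf))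
  not-special : ¬ IsSpecialRoman Petersen
  not-special (f , (rdf , minimal) , no1 , paired) =
    10+t≤4t⇒2t≰6 (total (χ₂ ∘ f)) (paired-bound rdf no1 paired)
      (≤-trans (m≤n+m _ (total (χ₁ ∘ f)))
               (subst (_≤ 6) (weight≡ones+2twos f) (minimal weightSixRDF weightSixRDF-isRDF)))
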